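{- For every graph $G$, $i_{\{R2\}}(G)< i_{dR}(G)$.
   Context: An independent double Roman dominating function (IDRDF) on a graph $G=(V,E)$ is a function $f:V\to\{0,1,2,3\}$ such that: every vertex $v$ with $f(v)=0$ has at least two neighbors $w$ with $f(w)=2$ or at least one neighbor $w$ with $f(w)=3$; every vertex $v$ with $f(v)=1$ has a neighbor $w$ with $f(w)\ge 2$; and $\{v: f(v)>0\}$ is independent. $i_{dR}(G)$ is the minimum weight $\sum_v f(v)$ of an IDRDF on $G$. A Roman $\{2\}$-dominating function is a function $g:V\to\{0,1,2\}$ such that every $v$ with $g(v)=0$ satisfies $\sum_{u\in N(v)}g(u)\ge 2$; it is independent if $\{v:g(v)>0\}$ is an independent set. $i_{\{R2\}}(G)$ is the minimum weight of an independent Roman $\{2\}$-dominating function on $G$. Graphs are finite, simple and have at least one vertex. -}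

module Defs where

open import Data.Nat using (ℕ; suc; _≤_; _<_)
open import Data.Bool using (Bool; true; false; if_then_else_)
open import Data.Fin using (Fin)
open import Data.List using (map; allFin)
open import Data.Nat.ListAction using (sum)
open import Data.Product using (∃; ∃-syntax; _×_; Σ)
open import Data.Sum using (_⊎_)
open import Relation.Binary.PropositionalEquality using (_≡_; _≢_)

record Graph (n : ℕ) : Set where
  field
    adj     : Fin n → Fin n → Bool
    sym     : ∀ u v → adj u v ≡ adj v u
    irrefl  : ∀ v → adj v v ≡ false

open Graph public

Adj : ∀ {n} → Graph n → Fin n → Fin n → Set
Adj G u v = adj G u v ≡ true

weight : ∀ {n} → (Fin n → ℕ) → ℕ
weight {n} f = sum (map f (allFin n))

nbrSum : ∀ {n} → Graph n → (Fin n → ℕ) → Fin n → ℕ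
nbrSum {n} G g v = sum (map (λ w → if adj G v w then g w else 0) (allFin n))

IndependentSupport : ∀ {n} → Graph n → (Fin n → ℕ) → Set
IndependentSupport G f = ∀ u v → Adj G u v → f u ≡ 0 ⊎ f v ≡ 0

IsIDRDF : ∀ {n} → Graph n → (Fin n → ℕ) → Set
IsIDRDF G f =
  (∀ v → f v ≤ 3)
  × (∀ v → f v ≡ 0 →
        (∃[ w ] (Adj G v w × f w ≡ 3))
        ⊎ (∃[ w₁ ] ∃[ w₂ ] (w₁ ≢ w₂ × Adj G v w₁ × Adj G v w₂ × f w₁ ≡ 2 × f w₂ ≡ 2)))
  × (∀ v → f v ≡ 1 → ∃[ w ] (Adj G v w × 2 ≤ f w))
  × IndependentSupport G f

IsIR2DF : ∀ {n} → Graph n → (Fin n → ℕ) → Set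
IsIR2DF G g =
  (∀ v → g v ≤ 2)
  × (∀ v → g v ≡ 0 → 2 ≤ nbrSum G g v)
  × IndependentSupport G g

-- f attains i_dR(G): it is an IDRDF of minimum weight
IsMinIDRDF : ∀ {n} → Graph n → (Fin n → ℕ) → Set
IsMinIDRDF G f = IsIDRDF G f × (∀ f' → IsIDRDF G f' → weight f ≤ weight f')

-- g attains i_{R2}(G): it is an independent Roman {2}-dominating function of minimum weight
IsMinIR2DF : ∀ {n} → Graph n → (Fin n → ℕ) → Set
IsMinIR2DF G g = IsIR2DF G g × (∀ g' → IsIR2DF G g' → weight g ≤ weight g')

module Submission where

-- Lower every label of an IDRDF f by one step along 3 ↦ 2 ↦ 1, keeping
-- 0 and 1 fixed ('demote').  The result g = demote ∘ f is an independent
-- Roman {2}-dominating function: its support equals that of f (so it is still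
-- independent), labels are ≤ 2, and a vertex with label 0 had either a
-- 3-neighbour (now a 2-neighbour) or two distinct 2-neighbours (now two
-- 1-neighbours), so its neighbourhood sum is ≥ 2.  Moreover demotion never
-- increases a label and strictly lowers every label ≥ 2; an IDRDF on a
-- nonempty graph always has such a label, hence weight g < weight f.

open import Defs
open import Data.Nat using (ℕ; zero; suc; _+_; _≤_; _<_; z≤n; s≤s)
open import Data.Nat.Properties
  using (≤-refl; ≤-trans; ≤-<-trans; n≤1+n; m≤m+n; m≤n+m; +-comm; +-mono-≤; +-monoʳ-≤; +-mono-<-≤; +-mono-≤-<)
open import Data.Fin using (Fin; zero; suc)
open import Data.Bool using (if_then_else_)
open import Data.List using (tabulate)
open import Data.List.Properties using (map-tabulate)
open import Data.Nat.ListAction using (sum)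
open import Data.Product using (∃-syntax; _,_)
open import Data.Sum using (inj₁; inj₂)
open import Data.Empty using (⊥-elim)
open import Function using (id; _∘_)
open import Relation.Binary.PropositionalEquality
  using (_≡_; _≢_; refl; cong; cong₂; subst; trans)
  renaming (sym to ≡-sym)

weight-suc : ∀ {n} (φ : Fin (suc n) → ℕ) → weight φ ≡ φ zero + weight (φ ∘ suc)
weight-suc φ =
  cong (λ xs → φ zero + sum xs)
    (trans (map-tabulate suc φ) (≡-sym (map-tabulate id (φ ∘ suc))))

value≤weight : ∀ {n} (φ : Fin n → ℕ) a → φ a ≤ weight φ
value≤weight φ zero rewrite weight-suc φ = m≤m+n _ _
value≤weight φ (suc a) rewrite weight-suc φ =
  ≤-trans (value≤weight (φ ∘ suc) a) (m≤n+m _ _)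

pair≤weight : ∀ {n} (φ : Fin n → ℕ) a b → a ≢ b → φ a + φ b ≤ weight φ
pair≤weight φ zero zero a≢b = ⊥-elim (a≢b refl)
pair≤weight φ zero (suc b) _ rewrite weight-suc φ =
  +-monoʳ-≤ (φ zero) (value≤weight (φ ∘ suc) b)
pair≤weight φ (suc a) zero _ rewrite weight-suc φ | +-comm (φ (suc a)) (φ zero) =
  +-monoʳ-≤ (φ zero) (value≤weight (φ ∘ suc) a)
pair≤weight φ (suc a) (suc b) a≢b rewrite weight-suc φ =
  ≤-trans (pair≤weight (φ ∘ suc) a b (a≢b ∘ cong suc)) (m≤n+m _ _)

weight-mono : ∀ {n} (φ ψ : Fin n → ℕ) → (∀ v → φ v ≤ ψ v) → weight φ ≤ weight ψ
weight-mono {zero} φ ψ φ≤ψ = z≤n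
weight-mono {suc n} φ ψ φ≤ψ rewrite weight-suc φ | weight-suc ψ =
  +-mono-≤ (φ≤ψ zero) (weight-mono (φ ∘ suc) (ψ ∘ suc) (φ≤ψ ∘ suc))

weight-strict : ∀ {n} (φ ψ : Fin n → ℕ) → (∀ v → φ v ≤ ψ v) →
  ∀ w → φ w < ψ w → weight φ < weight ψ
weight-strict φ ψ φ≤ψ zero φw<ψw rewrite weight-suc φ | weight-suc ψ =
  +-mono-<-≤ φw<ψw (weight-mono (φ ∘ suc) (ψ ∘ suc) (φ≤ψ ∘ suc))
weight-strict φ ψ φ≤ψ (suc w) φw<ψw rewrite weight-suc φ | weight-suc ψ =
  +-mono-≤-< (φ≤ψ zero) (weight-strict (φ ∘ suc) (ψ ∘ suc) (φ≤ψ ∘ suc) w φw<ψw)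

-- The neighbourhood sum of v is the weight of h masked to N(v); on a
-- neighbour the mask is transparent.
masked-neighbour : ∀ {n} (G : Graph n) (h : Fin n → ℕ) {v w} → Adj G v w →
  (if adj G v w then h w else 0) ≡ h w
masked-neighbour G h vw rewrite vw = refl

neighbour≤nbrSum : ∀ {n} (G : Graph n) (h : Fin n → ℕ) v w → Adj G v w → h w ≤ nbrSum G h v
neighbour≤nbrSum G h v w vw =
  subst (_≤ nbrSum G h v) (masked-neighbour G h vw)
    (value≤weight (λ u → if adj G v u then h u else 0) w)

neighbours≤nbrSum : ∀ {n} (G : Graph n) (h : Fin n → ℕ) v w₁ w₂ → w₁ ≢ w₂ →
  Adj G v w₁ → Adj G v w₂ → h w₁ + h w₂ ≤ nbrSum G h v
neighbours≤nbrSum G h v w₁ w₂ w₁≢w₂ vw₁ vw₂ =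
  subst (_≤ nbrSum G h v) (cong₂ _+_ (masked-neighbour G h vw₁) (masked-neighbour G h vw₂))
    (pair≤weight (λ u → if adj G v u then h u else 0) w₁ w₂ w₁≢w₂)

demote : ℕ → ℕ
demote zero = zero
demote (suc zero) = suc zero
demote (suc (suc k)) = suc k

-- Demotion maps exactly 0 to 0 (demote 0 = 0 holds by definition), so it
-- preserves the support.
demote≡0 : ∀ k → demote k ≡ 0 → k ≡ 0
demote≡0 zero _ = refl
demote≡0 (suc zero) ()
demote≡0 (suc (suc k)) ()

demote≤ : ∀ k → demote k ≤ k
demote≤ zero = z≤n
demote≤ (suc zero) = ≤-refl
demote≤ (suc (suc k)) = n≤1+n _

demote< : ∀ k → 2 ≤ k → demote k < k
demote< (suc zero) (s≤s ())
demote< (suc (suc k)) _ = ≤-refl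

demote≤2 : ∀ k → k ≤ 3 → demote k ≤ 2
demote≤2 zero _ = z≤n
demote≤2 (suc zero) _ = s≤s z≤n
demote≤2 (suc (suc k)) (s≤s (s≤s k≤1)) = s≤s k≤1

demote-IR2DF : ∀ {n} (G : Graph n) (f : Fin n → ℕ) → IsIDRDF G f → IsIR2DF G (demote ∘ f)
demote-IR2DF G f (f≤3 , dom0 , _ , indep) = (λ v → demote≤2 (f v) (f≤3 v)) , dom , indep'
  where
  dom : ∀ v → demote (f v) ≡ 0 → 2 ≤ nbrSum G (demote ∘ f) v
  dom v gv≡0 with dom0 v (demote≡0 (f v) gv≡0)
  ... | inj₁ (w , vw , fw≡3) =
    subst (_≤ nbrSum G (demote ∘ f) v) (cong demote fw≡3)
      (neighbour≤nbrSum G (demote ∘ f) v w vw)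
  ... | inj₂ (w₁ , w₂ , w₁≢w₂ , vw₁ , vw₂ , fw₁≡2 , fw₂≡2) =
    subst (_≤ nbrSum G (demote ∘ f) v) (cong₂ _+_ (cong demote fw₁≡2) (cong demote fw₂≡2))
      (neighbours≤nbrSum G (demote ∘ f) v w₁ w₂ w₁≢w₂ vw₁ vw₂)
  indep' : IndependentSupport G (demote ∘ f)
  indep' u v uv with indep u v uv
  ... | inj₁ fu≡0 = inj₁ (cong demote fu≡0)
  ... | inj₂ fv≡0 = inj₂ (cong demote fv≡0)

-- An IDRDF on a nonempty graph has a label ≥ 2: inspect vertex zero; label 0
-- or 1 forces a neighbour with label ≥ 2.
IDRDF-has-big-label : ∀ {n} (G : Graph (suc n)) (f : Fin (suc n) → ℕ) → IsIDRDF G f →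
  ∃[ w ] (2 ≤ f w)
IDRDF-has-big-label G f (_ , dom0 , _ , _) with f zero in f0
... | zero with dom0 zero f0
...   | inj₁ (w , _ , fw≡3) = w , subst (2 ≤_) (≡-sym fw≡3) (s≤s (s≤s z≤n))
...   | inj₂ (w , _ , _ , _ , _ , fw≡2 , _) = w , subst (2 ≤_) (≡-sym fw≡2) ≤-refl
IDRDF-has-big-label G f (_ , _ , dom1 , _) | suc zero with dom1 zero f0
...   | w , _ , 2≤fw = w , 2≤fw
IDRDF-has-big-label G f _ | suc (suc k) = zero , subst (2 ≤_) (≡-sym f0) (s≤s (s≤s z≤n))

demote-weight< : ∀ {n} (G : Graph (suc n)) (f : Fin (suc n) → ℕ) → IsIDRDF G f →
  weight (demote ∘ f) < weight f
demote-weight< G f fI with IDRDF-has-big-label G f fI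
... | w , 2≤fw = weight-strict (demote ∘ f) f (demote≤ ∘ f) w (demote< (f w) 2≤fw)

corollary6 : ∀ (n : ℕ) (G : Graph (suc n)) (f g : Fin (suc n) → ℕ) →
    IsMinIDRDF G f → IsMinIR2DF G g → weight g < weight f
corollary6 n G f g (f-IDRDF , _) (_ , g-minimal) =
  ≤-<-trans (g-minimal (demote ∘ f) (demote-IR2DF G f f-IDRDF))
            (demote-weight< G f f-IDRDF)
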